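{- Let $p\geq3$ be prime, $l\geq1$, and let $h_1,\ldots,h_l\in\mathbb F_p$. Suppose that in the list of the $2^l$ elements $\sum_{i\in I}h_i$ for $I\subseteq\{1,\ldots,l\}$ (counted with multiplicity), every element occurs with even multiplicity. Then $h_i=0$ for at least one $i$. -}

module Defs where

open import Data.Nat using (ℕ; zero; suc; NonZero)
import Data.Nat as ℕ
open import Data.Nat.DivMod using (_mod_)
open import Data.Fin using (Fin; toℕ)
open import Data.Fin.Properties using (_≟_)
open import Data.List using (List; []; _∷_; _++_; map; length; filter)
open import Data.Vec using (Vec; []; _∷_)

𝔽 : ℕ → Set
𝔽 p = Fin p

_+ₚ_ : ∀ {p} .{{_ : NonZero p}} → 𝔽 p → 𝔽 p → 𝔽 p
_+ₚ_ {p} a b = (toℕ a ℕ.+ toℕ b) mod p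

0ₚ : ∀ {p} .{{_ : NonZero p}} → 𝔽 p
0ₚ {p} = 0 mod p

-- The list (with multiplicity) of the 2^l subset sums  Σ_{i∈I} h_i,
-- I ⊆ {1..l}: each subset I corresponds to one entry (exclude/include h_1,
-- then recursively the rest).
subsetSums : ∀ {p l} .{{_ : NonZero p}} → Vec (𝔽 p) l → List (𝔽 p)
subsetSums [] = 0ₚ ∷ []
subsetSums (h ∷ hs) = subsetSums hs ++ map (h +ₚ_) (subsetSums hs)

multiplicity : ∀ {p} → 𝔽 p → List (𝔽 p) → ℕ
multiplicity x xs = length (filter (x ≟_) xs)

{-# OPTIONS --safe #-}
-- Let F x be the parity of the multiplicity of x among the subset sums.  Adjoining h to
-- the family turns F into z ↦ F z + F (z − h).  For the empty family F is nonconstant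
-- (only 0 is hit), and nonconstancy survives adjoining any h ≠ 0: if F (h + z) + F z were
-- a constant c, then going once around the cycle of translations by h gives p c = 0, so
-- c = 0 as p is odd; F would then be h-periodic, hence constant since h generates 𝔽 p.
-- A nonconstant F is not identically even, so some hᵢ = 0.
module Submission where

open import Defs
open import Data.Nat using (ℕ; NonZero; _≤_)
open import Data.Nat.Divisibility using (_∣_)
open import Data.Nat.Primality using (Prime)
open import Data.Fin using (Fin)
open import Data.Vec using (Vec; lookup)
open import Data.Product using (∃)
open import Relation.Binary.PropositionalEquality using (_≡_)

open import Data.Nat using (zero; suc; _+_; _*_; _∸_; _<_; _%_; parity; ≢-nonZero; >-nonZero⁻¹; nonTrivial⇒n>1)
open import Data.Nat.Properties using (+-assoc; +-comm; *-comm; m∸n+n≡m; <⇒≤; <⇒≢)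
open import Data.Nat.DivMod using (_mod_; %-distribˡ-+; [m+n]%n≡m%n; m<n⇒m%n≡m)
open import Data.Nat.Divisibility using (divides; ∣-refl; ∣m∣n⇒∣m+n)
open import Data.Nat.GCD using (module Bézout)
open import Data.Nat.Coprimality using (Coprime; coprime-Bézout; prime⇒coprime)
open import Data.Nat.Primality using (composite-≢; prime⇒¬composite; prime⇒nonTrivial; prime⇒nonZero)
open import Data.Fin using (toℕ; zero; suc)
open import Data.Fin.Properties using (toℕ-injective; toℕ-fromℕ<; toℕ<n; ¬∀⟶∃¬; any?; _≟_)
open import Data.Parity.Base as ℙ using (Parity; 0ℙ; 1ℙ)
open import Data.Parity.Properties using (+-homo-+; *-homo-*; *-zeroʳ; *-distribʳ-+; +-cancelʳ-≡) renaming (_≟_ to _≟ℙ_; +-assoc to +ℙ-assoc)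
open import Data.List using (List; []; _∷_; _++_; map; length; filter)
open import Data.List.Properties using (filter-++; length-++; filter-accept; filter-reject)
open import Data.Vec using ([]; _∷_)
open import Data.Product using (∃₂; _,_)
open import Function using (_∘_)
open import Function.Definitions using (Injective)
import Level
open import Relation.Nullary using (¬_; yes; no; contradiction)
open import Relation.Binary.PropositionalEquality using (_≢_; refl; sym; trans; cong; cong₂; module ≡-Reasoning)
open ≡-Reasoning

module _ {a} {A : Set a} where

  Periodic : (ℕ → A) → ℕ → Set a
  Periodic g t = ∀ n → g (t + n) ≡ g n

  periodic-* : ∀ {g t} → Periodic g t → ∀ k → Periodic g (k * t)
  periodic-* per zero    n = refl
  periodic-* {g} {t} per (suc k) n = begin
    g (t + k * t + n)   ≡⟨ cong g (+-assoc t (k * t) n) ⟩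
    g (t + (k * t + n)) ≡⟨ per (k * t + n) ⟩
    g (k * t + n)       ≡⟨ periodic-* per k n ⟩
    g n                 ∎

  periodic-combination : ∀ {g s t d} → Periodic g s → Periodic g t →
                         ∀ j k → d + j * s ≡ k * t → Periodic g d
  periodic-combination {g} {s} {t} {d} per-s per-t j k eq n = begin
    g (d + n)           ≡⟨ periodic-* per-s j (d + n) ⟨
    g (j * s + (d + n)) ≡⟨ cong g combine ⟩
    g (k * t + n)       ≡⟨ periodic-* per-t k n ⟩
    g n                 ∎
    where
    combine : j * s + (d + n) ≡ k * t + n
    combine = begin
      j * s + (d + n) ≡⟨ +-assoc (j * s) d n ⟨
      j * s + d + n   ≡⟨ cong (_+ n) (+-comm (j * s) d) ⟩
      d + j * s + n   ≡⟨ cong (_+ n) eq ⟩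
      k * t + n       ∎

  periodic-1⇒constant : ∀ {g} → Periodic g 1 → ∀ n → g n ≡ g 0
  periodic-1⇒constant per zero    = refl
  periodic-1⇒constant per (suc n) = trans (per n) (periodic-1⇒constant per n)

  coprime-periods⇒constant : ∀ {g m n} → Periodic g m → Periodic g n → Coprime m n →
                             ∀ i → g i ≡ g 0
  coprime-periods⇒constant per-m per-n m⊥n with coprime-Bézout m⊥n
  ... | Bézout.+- x y eq = periodic-1⇒constant (periodic-combination per-n per-m y x eq)
  ... | Bézout.-+ x y eq = periodic-1⇒constant (periodic-combination per-m per-n x y eq)

x≡x+y+y : ∀ x y → x ≡ (x ℙ.+ y) ℙ.+ y
x≡x+y+y 0ℙ 0ℙ = refl
x≡x+y+y 0ℙ 1ℙ = refl
x≡x+y+y 1ℙ 0ℙ = refl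
x≡x+y+y 1ℙ 1ℙ = refl

parity-suc-* : ∀ k c → parity (suc k) ℙ.* c ≡ c ℙ.+ (parity k ℙ.* c)
parity-suc-* k c = trans (cong (ℙ._* c) (+-homo-+ 1 k)) (*-distribʳ-+ c 1ℙ (parity k))

2∣⇒parity≡0ℙ : ∀ {n} → 2 ∣ n → parity n ≡ 0ℙ
2∣⇒parity≡0ℙ (divides q refl) = trans (*-homo-* q 2) (*-zeroʳ (parity q))

parity≡0ℙ⇒2∣ : ∀ n → parity n ≡ 0ℙ → 2 ∣ n
parity≡0ℙ⇒2∣ zero          _ = divides 0 refl
parity≡0ℙ⇒2∣ (suc (suc n)) e = ∣m∣n⇒∣m+n ∣-refl (parity≡0ℙ⇒2∣ n e)

prime≥3⇒parity≡1ℙ : ∀ {p} → Prime p → 3 ≤ p → parity p ≡ 1ℙ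
prime≥3⇒parity≡1ℙ {p} pr 3≤p with parity p in eq
... | 1ℙ = refl
... | 0ℙ = contradiction (composite-≢ 2 {{_}} {{prime⇒nonZero pr}} (<⇒≢ 3≤p) (parity≡0ℙ⇒2∣ p eq))
                        (prime⇒¬composite pr)

shift-* : ∀ {g : ℕ → Parity} {t c} → (∀ n → g (t + n) ≡ c ℙ.+ g n) →
          ∀ k n → g (k * t + n) ≡ (parity k ℙ.* c) ℙ.+ g n
shift-* sh zero    n = refl
shift-* {g} {t} {c} sh (suc k) n = begin
  g (t + k * t + n)                ≡⟨ cong g (+-assoc t (k * t) n) ⟩
  g (t + (k * t + n))              ≡⟨ sh (k * t + n) ⟩
  c ℙ.+ g (k * t + n)              ≡⟨ cong (c ℙ.+_) (shift-* sh k n) ⟩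
  c ℙ.+ ((parity k ℙ.* c) ℙ.+ g n) ≡⟨ +ℙ-assoc c _ (g n) ⟨
  (c ℙ.+ (parity k ℙ.* c)) ℙ.+ g n ≡⟨ cong (ℙ._+ g n) (parity-suc-* k c) ⟨
  (parity (suc k) ℙ.* c) ℙ.+ g n   ∎

-- g (m t) is reached from g 0 both by m periods and by m shifts; for odd m the shifts add up to c.
odd-period⇒shift≡0ℙ : ∀ {g : ℕ → Parity} {m t c} → Periodic g m → parity m ≡ 1ℙ →
                      (∀ n → g (t + n) ≡ c ℙ.+ g n) → c ≡ 0ℙ
odd-period⇒shift≡0ℙ {g} {m} {t} {c} per m-odd sh = +-cancelʳ-≡ (g 0) c 0ℙ (begin
  c ℙ.+ g 0                ≡⟨ cong (λ q → (q ℙ.* c) ℙ.+ g 0) m-odd ⟨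
  (parity m ℙ.* c) ℙ.+ g 0 ≡⟨ shift-* sh m 0 ⟨
  g (m * t + 0)            ≡⟨ cong (λ q → g (q + 0)) (*-comm m t) ⟩
  g (t * m + 0)            ≡⟨ periodic-* per t 0 ⟩
  g 0                      ∎)

module _ {p : ℕ} where

  multiplicity-++ : ∀ x (A B : List (𝔽 p)) →
                    multiplicity x (A ++ B) ≡ multiplicity x A + multiplicity x B
  multiplicity-++ x A B = trans (cong length (filter-++ (x ≟_) A B)) (length-++ (filter (x ≟_) A))

  multiplicity-map : ∀ {f : 𝔽 p → 𝔽 p} → Injective _≡_ _≡_ f →
                     ∀ y A → multiplicity (f y) (map f A) ≡ multiplicity y A
  multiplicity-map f-inj y [] = refl
  multiplicity-map {f} f-inj y (a ∷ A) with y ≟ a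
  ... | yes refl = trans (cong length (filter-accept (f y ≟_) refl)) (cong suc (multiplicity-map f-inj y A))
  ... | no y≢a   = trans (cong length (filter-reject (f y ≟_) (y≢a ∘ f-inj))) (multiplicity-map f-inj y A)

  parityProfile : List (𝔽 p) → 𝔽 p → Parity
  parityProfile L x = parity (multiplicity x L)

NonConstant : ∀ {a b} {A : Set a} {B : Set b} → (A → B) → Set (a Level.⊔ b)
NonConstant f = ∃₂ λ x y → f x ≢ f y

module _ {p : ℕ} .{{_ : NonZero p}} where

  toℕ-mod : ∀ n → toℕ (n mod p) ≡ n % p
  toℕ-mod n = toℕ-fromℕ< _

  mod-toℕ : ∀ (x : 𝔽 p) → toℕ x mod p ≡ x
  mod-toℕ x = toℕ-injective (trans (toℕ-mod (toℕ x)) (m<n⇒m%n≡m (toℕ<n x)))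

  mod-injective : ∀ {m n} → m < p → n < p → m mod p ≡ n mod p → m ≡ n
  mod-injective {m} {n} m<p n<p e = begin
    m             ≡⟨ m<n⇒m%n≡m m<p ⟨
    m % p         ≡⟨ toℕ-mod m ⟨
    toℕ (m mod p) ≡⟨ cong toℕ e ⟩
    toℕ (n mod p) ≡⟨ toℕ-mod n ⟩
    n % p         ≡⟨ m<n⇒m%n≡m n<p ⟩
    n             ∎

  mod-homo-+ : ∀ m n → (m mod p) +ₚ (n mod p) ≡ (m + n) mod p
  mod-homo-+ m n = toℕ-injective (begin
    toℕ ((m mod p) +ₚ (n mod p))        ≡⟨ toℕ-mod _ ⟩
    (toℕ (m mod p) + toℕ (n mod p)) % p ≡⟨ cong₂ (λ a b → (a + b) % p) (toℕ-mod m) (toℕ-mod n) ⟩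
    (m % p + n % p) % p                 ≡⟨ %-distribˡ-+ m n p ⟨
    (m + n) % p                         ≡⟨ toℕ-mod (m + n) ⟨
    toℕ ((m + n) mod p)                 ∎)

  mod-periodic : ∀ n → (p + n) mod p ≡ n mod p
  mod-periodic n = toℕ-injective (begin
    toℕ ((p + n) mod p) ≡⟨ toℕ-mod (p + n) ⟩
    (p + n) % p         ≡⟨ cong (_% p) (+-comm p n) ⟩
    (n + p) % p         ≡⟨ [m+n]%n≡m%n n p ⟩
    n % p               ≡⟨ toℕ-mod n ⟨
    toℕ (n mod p)       ∎)

  +ₚ-mod : ∀ (h : 𝔽 p) n → h +ₚ (n mod p) ≡ (toℕ h + n) mod p
  +ₚ-mod h n = trans (cong (_+ₚ (n mod p)) (sym (mod-toℕ h))) (mod-homo-+ (toℕ h) n)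

  translation-lift : ∀ {b} {B : Set b} (h : 𝔽 p) (F G : 𝔽 p → B) → (∀ z → F (h +ₚ z) ≡ G z) →
                     ∀ n → F ((toℕ h + n) mod p) ≡ G (n mod p)
  translation-lift h F G F∘h≗G n = trans (cong F (sym (+ₚ-mod h n))) (F∘h≗G (n mod p))

  translation-invariant⇒constant : ∀ {b} {B : Set b} → Prime p → (h : 𝔽 p) → h ≢ 0ₚ →
                                   (F : 𝔽 p → B) → (∀ z → F (h +ₚ z) ≡ F z) → ∀ x y → F x ≡ F y
  translation-invariant⇒constant pr h h≢0 F invariant x y = begin
    F x             ≡⟨ cong F (mod-toℕ x) ⟨
    F (toℕ x mod p) ≡⟨ constant (toℕ x) ⟩
    F (0 mod p)     ≡⟨ constant (toℕ y) ⟨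
    F (toℕ y mod p) ≡⟨ cong F (mod-toℕ y) ⟩
    F y             ∎
    where
    instance
      h-nonZero : NonZero (toℕ h)
      h-nonZero = ≢-nonZero λ h≡0 → h≢0 (trans (sym (mod-toℕ h)) (cong (_mod p) h≡0))
    constant : ∀ n → F (n mod p) ≡ F (0 mod p)
    constant = coprime-periods⇒constant (λ n → cong F (mod-periodic n))
                 (translation-lift h F F invariant) (prime⇒coprime pr (toℕ<n h))

  translation-shift≡0ℙ : parity p ≡ 1ℙ → (h : 𝔽 p) (F : 𝔽 p → Parity) {c : Parity} →
                         (∀ z → F (h +ₚ z) ≡ c ℙ.+ F z) → c ≡ 0ℙ
  translation-shift≡0ℙ p-odd h F shift =
    odd-period⇒shift≡0ℙ (λ n → cong F (mod-periodic n)) p-odd (translation-lift h F _ shift)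

  +ₚ-injective : (h : 𝔽 p) → Injective _≡_ _≡_ (h +ₚ_)
  +ₚ-injective h {a} {b} e = begin
    a              ≡⟨ translate-back a ⟨
    h⁻ +ₚ (h +ₚ a) ≡⟨ cong (h⁻ +ₚ_) e ⟩
    h⁻ +ₚ (h +ₚ b) ≡⟨ translate-back b ⟩
    b              ∎
    where
    h⁻ : 𝔽 p
    h⁻ = (p ∸ toℕ h) mod p
    translate-back : ∀ x → h⁻ +ₚ (h +ₚ x) ≡ x
    translate-back x = begin
      h⁻ +ₚ ((toℕ h + toℕ x) mod p)       ≡⟨ mod-homo-+ (p ∸ toℕ h) (toℕ h + toℕ x) ⟩
      (p ∸ toℕ h + (toℕ h + toℕ x)) mod p ≡⟨ cong (_mod p) (+-assoc (p ∸ toℕ h) (toℕ h) (toℕ x)) ⟨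
      (p ∸ toℕ h + toℕ h + toℕ x) mod p   ≡⟨ cong (λ q → (q + toℕ x) mod p) (m∸n+n≡m (<⇒≤ (toℕ<n h))) ⟩
      (p + toℕ x) mod p                   ≡⟨ mod-periodic (toℕ x) ⟩
      toℕ x mod p                         ≡⟨ mod-toℕ x ⟩
      x                                   ∎

  parityProfile-translate : ∀ (h : 𝔽 p) L z → parityProfile (L ++ map (h +ₚ_) L) (h +ₚ z) ≡
                            parityProfile L (h +ₚ z) ℙ.+ parityProfile L z
  parityProfile-translate h L z = begin
    parity (multiplicity (h +ₚ z) (L ++ map (h +ₚ_) L))
      ≡⟨ cong parity (multiplicity-++ (h +ₚ z) L (map (h +ₚ_) L)) ⟩
    parity (multiplicity (h +ₚ z) L + multiplicity (h +ₚ z) (map (h +ₚ_) L))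
      ≡⟨ cong (λ m → parity (multiplicity (h +ₚ z) L + m)) (multiplicity-map (+ₚ-injective h) z L) ⟩
    parity (multiplicity (h +ₚ z) L + multiplicity z L)
      ≡⟨ +-homo-+ (multiplicity (h +ₚ z) L) (multiplicity z L) ⟩
    parityProfile L (h +ₚ z) ℙ.+ parityProfile L z
      ∎

  nonConstant-step : Prime p → parity p ≡ 1ℙ → (h : 𝔽 p) → h ≢ 0ₚ → (L : List (𝔽 p)) →
                     NonConstant (parityProfile L) → NonConstant (parityProfile (L ++ map (h +ₚ_) L))
  nonConstant-step pr p-odd h h≢0 L (x , y , Fx≢Fy) =
    differing-translates (¬∀⟶∃¬ p (λ z → d z ≡ d 0ₚ) (λ z → d z ≟ℙ d 0ₚ) d-nonConstant)
    where
    F : 𝔽 p → Parity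
    F = parityProfile L
    d : 𝔽 p → Parity
    d z = F (h +ₚ z) ℙ.+ F z
    d-nonConstant : ¬ (∀ z → d z ≡ d 0ₚ)
    d-nonConstant d-const = Fx≢Fy (translation-invariant⇒constant pr h h≢0 F invariant x y)
      where
      shift : ∀ z → F (h +ₚ z) ≡ d 0ₚ ℙ.+ F z
      shift z = trans (x≡x+y+y (F (h +ₚ z)) (F z)) (cong (ℙ._+ F z) (d-const z))
      invariant : ∀ z → F (h +ₚ z) ≡ F z
      invariant z = trans (shift z) (cong (ℙ._+ F z) (translation-shift≡0ℙ p-odd h F {d 0ₚ} shift))
    differing-translates : ∃ (λ z → d z ≢ d 0ₚ) → NonConstant (parityProfile (L ++ map (h +ₚ_) L))
    differing-translates (z , dz≢d0) = h +ₚ z , h +ₚ 0ₚ , λ e → dz≢d0 (begin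
      d z                                           ≡⟨ parityProfile-translate h L z ⟨
      parityProfile (L ++ map (h +ₚ_) L) (h +ₚ z)  ≡⟨ e ⟩
      parityProfile (L ++ map (h +ₚ_) L) (h +ₚ 0ₚ) ≡⟨ parityProfile-translate h L 0ₚ ⟩
      d 0ₚ                                          ∎)

  nonConstant-[0ₚ] : 1 < p → NonConstant (parityProfile (0ₚ {p} ∷ []))
  nonConstant-[0ₚ] 1<p = 0ₚ , 1 mod p , λ e → contradiction (trans (sym zero-odd) (trans e one-even)) λ ()
    where
    1≢0 : 1 mod p ≢ 0ₚ
    1≢0 e = contradiction (mod-injective 1<p (>-nonZero⁻¹ p) e) λ ()
    zero-odd : parityProfile (0ₚ ∷ []) 0ₚ ≡ 1ℙ
    zero-odd = cong (parity ∘ length) (filter-accept (0ₚ ≟_) refl)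
    one-even : parityProfile (0ₚ ∷ []) (1 mod p) ≡ 0ℙ
    one-even = cong (parity ∘ length) (filter-reject ((1 mod p) ≟_) 1≢0)

  nonConstant-subsetSums : Prime p → parity p ≡ 1ℙ → ∀ {l} (h : Vec (𝔽 p) l) →
                           (∀ i → lookup h i ≢ 0ₚ) → NonConstant (parityProfile (subsetSums h))
  nonConstant-subsetSums pr p-odd []       _  = nonConstant-[0ₚ] (nonTrivial⇒n>1 p {{prime⇒nonTrivial pr}})
  nonConstant-subsetSums pr p-odd (h ∷ hs) h≢0 =
    nonConstant-step pr p-odd h (h≢0 zero) (subsetSums hs) (nonConstant-subsetSums pr p-odd hs (h≢0 ∘ suc))

lemma5 : (p : ℕ) .{{_ : NonZero p}} → Prime p → 3 ≤ p →
         (l : ℕ) → 1 ≤ l → (h : Vec (𝔽 p) l) →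
         (∀ (x : 𝔽 p) → 2 ∣ multiplicity x (subsetSums h)) →
         ∃ λ (i : Fin l) → lookup h i ≡ 0ₚ
lemma5 p pr 3≤p _ _ h all-even with any? (λ i → lookup h i ≟ 0ₚ)
... | yes zero-entry = zero-entry
... | no no-zero-entry with nonConstant-subsetSums pr (prime≥3⇒parity≡1ℙ pr 3≤p) h (λ i e → no-zero-entry (i , e))
...   | x , y , Fx≢Fy = contradiction (trans (even x) (sym (even y))) Fx≢Fy
  where
  even : ∀ z → parityProfile (subsetSums h) z ≡ 0ℙ
  even z = 2∣⇒parity≡0ℙ (all-even z)
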